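{- Let $n\ge 0$ be an integer, let $a,b,r$ be complex numbers, and fix a choice of sign $\pm$ (with $\mp$ denoting the opposite sign). Let $M^\pm_n(a,b,r)$ be the $(n+1)\times(n+1)$ tridiagonal matrix with rows and columns indexed by $0,1,\ldots,n$, whose entries are $$(M^\pm_n)_{i,i}=\big((n-i)a\pm i b\big)r\ (0\le i\le n),\qquad (M^\pm_n)_{i,i+1}=(i+1)b,\qquad (M^\pm_n)_{i+1,i}=(n-i)a\ (0\le i\le n-1),$$ and all other entries $0$; that is, $$M^\pm_n(a,b,r)=\begin{pmatrix} nar & b & & & & \\ na & ((n-1)a\pm b)r & 2b & & & \\ & (n-1)a & ((n-2)a\pm 2b)r & 3b & & \\ & & (n-2)a & \ddots & \ddots & \\ & & & \ddots & \ddots & nb \\ & & & & a & \pm nbr \end{pmatrix}.$$ Then the eigenvalues of $M^\pm_n(a,b,r)$ (counted with algebraic multiplicity) are $$\frac{1}{2}\left(nr(a\pm b)+(n-2k)\sqrt{4ab+r^2(a\mp b)^2}\right),\qquad k=0,1,\ldots,n,$$ where $\sqrt{4ab+r^2(a\mp b)^2}$ denotes a fixed choice of square root. -}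

module Defs where

open import Level using (Level)
open import Algebra.Bundles using (CommutativeRing)
open import Data.Nat as ℕ using (ℕ; zero; suc; _∸_)
open import Data.Fin using (Fin; zero; suc; toℕ; punchIn)
open import Data.Bool using (Bool; true; false; if_then_else_)
open import Relation.Nullary using (yes; no)

module _ {c ℓ : Level} (R : CommutativeRing c ℓ) where
  open CommutativeRing R hiding (zero)

  fromℕ : ℕ → Carrier
  fromℕ zero    = 0#
  fromℕ (suc m) = 1# + fromℕ m

  pm : Bool → Carrier → Carrier
  pm true x = x
  pm false x = - x

  altSign : ℕ → Carrier → Carrier
  altSign zero    x = x
  altSign (suc j) x = - altSign j x

  Matrix : ℕ → Set c
  Matrix m = Fin m → Fin m → Carrier

  sumFin : (m : ℕ) → (Fin m → Carrier) → Carrier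
  sumFin zero    f = 0#
  sumFin (suc m) f = f zero + sumFin m (λ j → f (suc j))

  prodℕ : ℕ → (ℕ → Carrier) → Carrier
  prodℕ zero    f = 1#
  prodℕ (suc m) f = prodℕ m f * f m

  det : (m : ℕ) → Matrix m → Carrier
  det zero    A = 1#
  det (suc m) A = sumFin (suc m) λ j →
    altSign (toℕ j) (A zero j * det m (λ p q → A (suc p) (punchIn j q)))

  charMat : (m : ℕ) → Carrier → Matrix m → Matrix m
  charMat m x A i j with toℕ i ℕ.≟ toℕ j
  ... | yes _ = x - A i j
  ... | no  _ = - A i j

  charPoly : (m : ℕ) → Matrix m → Carrier → Carrier
  charPoly m A x = det m (charMat m x A)

  M : (σ : Bool) (n : ℕ) (a b r : Carrier) → Matrix (suc n)
  M σ n a b r i j with toℕ i ℕ.≟ toℕ j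
  ... | yes _ = (fromℕ (n ∸ toℕ i) * a + pm σ (fromℕ (toℕ i) * b)) * r
  ... | no _ with suc (toℕ i) ℕ.≟ toℕ j
  ...   | yes _ = fromℕ (toℕ j) * b
  ...   | no _ with toℕ i ℕ.≟ suc (toℕ j)
  ...     | yes _ = fromℕ (n ∸ toℕ j) * a
  ...     | no _  = 0#

  -- the k-th claimed eigenvalue
  -- ½ ( n r (a ± b) + (n − 2k) s ),  where half is ½ and s the chosen square root;
  -- (n − 2k) s is written as (n − k) s − k s  (k ≤ n)
  eigen : (σ : Bool) (n : ℕ) (a b r half s : Carrier) → ℕ → Carrier
  eigen σ n a b r half s k =
    half * (fromℕ n * r * (a + pm σ (b)) + (fromℕ (n ∸ k) * s - fromℕ k * s))

-- x I − M is tridiagonal, so its determinant is the continuant of its diagonal and of the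
-- products of opposite off-diagonal entries. With c = ½(r(a ∓ b) + s) one has c(s − c) = ab, and
-- with y = x − ½n(r(a ± b) + s) the diagonal entry of row i becomes y + m s + (i − m) c for
-- m = n − i, while the entries (i, i+1) and (i+1, i) multiply to (i + 1)(n − i) c(s − c).
-- Such a continuant of Sylvester–Kac shape does not depend on c: the polynomials
-- kac (K+1) y i = y · kac K (y + s) i + i c · kac K y (i + 1) satisfy its three-term recurrence,
-- and kac (n+1) y 0 = ∏ₖ (y + k s), which is ∏ₖ (x − λₖ).
module Submission where

open import Level using (Level)
open import Algebra.Bundles using (CommutativeRing)
open import Algebra.Solver.Ring.AlmostCommutativeRing
  using (fromCommutativeRing; _-Raw-AlmostCommutative⟶_)
open import Data.Bool using (Bool; true; false; not)
open import Data.Fin using (Fin; zero; suc; toℕ; punchIn)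
open import Data.Integer as ℤ using (ℤ; +_; -[1+_])
import Data.Integer.Properties as ℤₚ
open import Data.Maybe using (Maybe; just; nothing)
open import Data.Nat as ℕ using (ℕ; zero; suc; _∸_; z≤n; s≤s)
import Data.Nat.Properties as ℕₚ
open import Data.Sign as Sign using (Sign)
open import Relation.Binary.PropositionalEquality as ≡ using (_≡_)
import Relation.Binary.Reasoning.Setoid
open import Relation.Nullary using (yes; no; contradiction)
open import Defs

module _ {ℓ₁ ℓ₂ : Level} (R : CommutativeRing ℓ₁ ℓ₂) where
  open CommutativeRing R hiding (zero)
  open import Algebra.Properties.Ring ring
    using (-0#≈0#; -‿involutive; -‿distribˡ-*; -‿distribʳ-*; -‿+-comm)
  open import Relation.Binary.Reasoning.Setoid setoid

  [_] : ℕ → Carrier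
  [_] = fromℕ R

  fromℕ-+ : ∀ m n → [ m ℕ.+ n ] ≈ [ m ] + [ n ]
  fromℕ-+ zero    n = sym (+-identityˡ _)
  fromℕ-+ (suc m) n = trans (+-congˡ (fromℕ-+ m n)) (sym (+-assoc _ _ _))

  fromℕ-+≡ : ∀ m n {k} → m ℕ.+ n ≡ k → [ m ] + [ n ] ≈ [ k ]
  fromℕ-+≡ m n ≡.refl = sym (fromℕ-+ m n)

  fromℕ-* : ∀ m n → [ m ℕ.* n ] ≈ [ m ] * [ n ]
  fromℕ-* zero    n = sym (zeroˡ _)
  fromℕ-* (suc m) n = begin
    [ n ℕ.+ m ℕ.* n ]       ≈⟨ fromℕ-+ n (m ℕ.* n) ⟩
    [ n ] + [ m ℕ.* n ]     ≈⟨ +-cong (sym (*-identityˡ _)) (fromℕ-* m n) ⟩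
    1# * [ n ] + [ m ] * [ n ] ≈⟨ distribʳ _ _ _ ⟨
    (1# + [ m ]) * [ n ]    ∎

  signed : Sign → Carrier → Carrier
  signed Sign.+ u = u
  signed Sign.- u = - u

  signed-cong : ∀ s {u v} → u ≈ v → signed s u ≈ signed s v
  signed-cong Sign.+ u≈v = u≈v
  signed-cong Sign.- u≈v = -‿cong u≈v

  signed-* : ∀ s t u v → signed (s Sign.* t) (u * v) ≈ signed s u * signed t v
  signed-* Sign.+ Sign.+ u v = refl
  signed-* Sign.+ Sign.- u v = -‿distribʳ-* u v
  signed-* Sign.- Sign.+ u v = -‿distribˡ-* u v
  signed-* Sign.- Sign.- u v =
    trans (sym (-‿involutive _)) (trans (-‿cong (-‿distribˡ-* u v)) (-‿distribʳ-* (- u) v))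

  fromℤ : ℤ → Carrier
  fromℤ i = signed (ℤ.sign i) [ ℤ.∣ i ∣ ]

  fromℤ-◃ : ∀ s n → fromℤ (s ℤ.◃ n) ≈ signed s [ n ]
  fromℤ-◃ Sign.+ zero    = refl
  fromℤ-◃ Sign.- zero    = sym -0#≈0#
  fromℤ-◃ Sign.+ (suc n) = refl
  fromℤ-◃ Sign.- (suc n) = refl

  fromℤ-* : ∀ i j → fromℤ (i ℤ.* j) ≈ fromℤ i * fromℤ j
  fromℤ-* i j = begin
    fromℤ (i ℤ.* j)                   ≈⟨ fromℤ-◃ (s Sign.* t) (∣i∣ ℕ.* ∣j∣) ⟩
    signed (s Sign.* t) [ ∣i∣ ℕ.* ∣j∣ ]   ≈⟨ signed-cong (s Sign.* t) (fromℕ-* ∣i∣ ∣j∣) ⟩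
    signed (s Sign.* t) ([ ∣i∣ ] * [ ∣j∣ ]) ≈⟨ signed-* s t _ _ ⟩
    fromℤ i * fromℤ j                 ∎
    where s = ℤ.sign i; t = ℤ.sign j; ∣i∣ = ℤ.∣ i ∣; ∣j∣ = ℤ.∣ j ∣

  fromℤ-neg : ∀ i → fromℤ (ℤ.- i) ≈ - fromℤ i
  fromℤ-neg (+ zero)  = sym -0#≈0#
  fromℤ-neg (+ suc n) = refl
  fromℤ-neg -[1+ n ]  = sym (-‿involutive _)

  fromℤ-⊖ : ∀ m n → fromℤ (m ℤ.⊖ n) ≈ [ m ] - [ n ]
  fromℤ-⊖ zero    zero    = sym (trans (+-congˡ -0#≈0#) (+-identityʳ _))
  fromℤ-⊖ zero    (suc n) = sym (+-identityˡ _)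
  fromℤ-⊖ (suc m) zero    = sym (trans (+-congˡ -0#≈0#) (+-identityʳ _))
  fromℤ-⊖ (suc m) (suc n) = begin
    fromℤ (suc m ℤ.⊖ suc n)        ≡⟨ ≡.cong fromℤ (ℤₚ.[1+m]⊖[1+n]≡m⊖n m n) ⟩
    fromℤ (m ℤ.⊖ n)                ≈⟨ fromℤ-⊖ m n ⟩
    [ m ] - [ n ]                  ≈⟨ +-identityˡ _ ⟨
    0# + ([ m ] - [ n ])           ≈⟨ +-congʳ (-‿inverseʳ 1#) ⟨
    (1# - 1#) + ([ m ] - [ n ])    ≈⟨ +-assoc 1# (- 1#) _ ⟩
    1# + (- 1# + ([ m ] - [ n ]))  ≈⟨ +-congˡ (x+[y+z]≈y+[x+z] (- 1#) [ m ] (- [ n ])) ⟩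
    1# + ([ m ] + (- 1# - [ n ]))  ≈⟨ +-assoc 1# [ m ] _ ⟨
    (1# + [ m ]) + (- 1# - [ n ])  ≈⟨ +-congˡ (-‿+-comm 1# [ n ]) ⟩
    (1# + [ m ]) - (1# + [ n ])    ∎
    where
    x+[y+z]≈y+[x+z] : ∀ u v w → u + (v + w) ≈ v + (u + w)
    x+[y+z]≈y+[x+z] u v w =
      trans (sym (+-assoc u v w)) (trans (+-congʳ (+-comm u v)) (+-assoc v u w))

  fromℤ-+ : ∀ i j → fromℤ (i ℤ.+ j) ≈ fromℤ i + fromℤ j
  fromℤ-+ -[1+ m ] -[1+ n ] = begin
    - (1# + (1# + [ m ℕ.+ n ]))    ≈⟨ -‿cong (+-congˡ (+-congˡ (fromℕ-+ m n))) ⟩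
    - (1# + (1# + ([ m ] + [ n ])))
      ≈⟨ -‿cong (+-congˡ (trans (sym (+-assoc _ _ _)) (trans (+-congʳ (+-comm _ _)) (+-assoc _ _ _)))) ⟩
    - (1# + ([ m ] + (1# + [ n ]))) ≈⟨ -‿cong (+-assoc _ _ _) ⟨
    - ((1# + [ m ]) + (1# + [ n ])) ≈⟨ -‿+-comm _ _ ⟨
    - (1# + [ m ]) + - (1# + [ n ]) ∎
  fromℤ-+ -[1+ m ] (+ n)    = trans (fromℤ-⊖ n (suc m)) (+-comm _ _)
  fromℤ-+ (+ m)    -[1+ n ] = fromℤ-⊖ m (suc n)
  fromℤ-+ (+ m)    (+ n)    = fromℕ-+ m n

  private
    ι : ℕ → Carrier
    ι zero          = 0#
    ι (suc zero)    = 1#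
    ι (suc (suc n)) = 1# + ι (suc n)

    ι≈[] : ∀ n → ι n ≈ [ n ]
    ι≈[] zero          = refl
    ι≈[] (suc zero)    = sym (+-identityʳ 1#)
    ι≈[] (suc (suc n)) = +-congˡ (ι≈[] (suc n))

  -- A copy of fromℤ sending 1 to 1# on the nose, so that the solver's constants
  -- match the goals definitionally.
  coefficient : ℤ → Carrier
  coefficient i = signed (ℤ.sign i) (ι ℤ.∣ i ∣)

  coefficient≈fromℤ : ∀ i → coefficient i ≈ fromℤ i
  coefficient≈fromℤ i = signed-cong (ℤ.sign i) (ι≈[] ℤ.∣ i ∣)

  coefficient-morphism : ℤ.+-*-rawRing -Raw-AlmostCommutative⟶ fromCommutativeRing R
  coefficient-morphism = record
    { ⟦_⟧    = coefficient
    ; +-homo = λ i j → via (i ℤ.+ j) (fromℤ-+ i j) (+-cong (coefficient≈fromℤ i) (coefficient≈fromℤ j))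
    ; *-homo = λ i j → via (i ℤ.* j) (fromℤ-* i j) (*-cong (coefficient≈fromℤ i) (coefficient≈fromℤ j))
    ; -‿homo = λ i → via (ℤ.- i) (fromℤ-neg i) (-‿cong (coefficient≈fromℤ i))
    ; 0-homo = refl
    ; 1-homo = refl
    }
    where
    via : ∀ i {u v} → fromℤ i ≈ u → v ≈ u → coefficient i ≈ v
    via i p q = trans (coefficient≈fromℤ i) (trans p (sym q))

  coefficient-≟ : ∀ i j → Maybe (coefficient i ≈ coefficient j)
  coefficient-≟ i j with i ℤₚ.≟ j
  ... | yes ≡.refl = just refl
  ... | no  _      = nothing

  open import Algebra.Solver.Ring ℤ.+-*-rawRing (fromCommutativeRing R) coefficient-morphism coefficient-≟
    using (Polynomial; con; _:+_; _:*_; _:-_; :-_; solve; _:=_)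

  1ₚ 0ₚ : ∀ {k} → Polynomial k
  1ₚ = con (+ 1)
  0ₚ = con (+ 0)

  -- Determinants of tridiagonal matrices

  sumFin-cong : ∀ m {f g : Fin m → Carrier} → (∀ j → f j ≈ g j) → sumFin R m f ≈ sumFin R m g
  sumFin-cong zero    f≈g = refl
  sumFin-cong (suc m) f≈g = +-cong (f≈g zero) (sumFin-cong m (λ j → f≈g (suc j)))

  sumFin-zero : ∀ m {f : Fin m → Carrier} → (∀ j → f j ≈ 0#) → sumFin R m f ≈ 0#
  sumFin-zero zero    f≈0 = refl
  sumFin-zero (suc m) f≈0 =
    trans (+-cong (f≈0 zero) (sumFin-zero m (λ j → f≈0 (suc j)))) (+-identityʳ 0#)

  altSign-cong : ∀ j {u v} → u ≈ v → altSign R j u ≈ altSign R j v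
  altSign-cong zero    u≈v = u≈v
  altSign-cong (suc j) u≈v = -‿cong (altSign-cong j u≈v)

  altSign-zero : ∀ j {u} → u ≈ 0# → altSign R j u ≈ 0#
  altSign-zero zero    u≈0 = u≈0
  altSign-zero (suc j) u≈0 = trans (-‿cong (altSign-zero j u≈0)) -0#≈0#

  det-cong : ∀ m {A B : Matrix R m} → (∀ i j → A i j ≈ B i j) → det R m A ≈ det R m B
  det-cong zero    A≈B = refl
  det-cong (suc m) A≈B = sumFin-cong (suc m) λ j →
    altSign-cong (toℕ j) (*-cong (A≈B zero j) (det-cong m (λ p q → A≈B (suc p) (punchIn j q))))

  det-zeroColumn : ∀ m (A : Matrix R (suc m)) → (∀ i → A i zero ≈ 0#) → det R (suc m) A ≈ 0#
  det-zeroColumn m A col≈0 = sumFin-zero (suc m) (term≈0 m A col≈0)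
    where
    term≈0 : ∀ m (A : Matrix R (suc m)) → (∀ i → A i zero ≈ 0#) → ∀ j →
             altSign R (toℕ j) (A zero j * det R m (λ p q → A (suc p) (punchIn j q))) ≈ 0#
    term≈0 m       A col≈0 zero    = trans (*-congʳ (col≈0 zero)) (zeroˡ _)
    term≈0 (suc m) A col≈0 (suc j) = altSign-zero (suc (toℕ j))
      (trans (*-congˡ (det-zeroColumn m (λ p q → A (suc p) (punchIn (suc j) q)) (λ i → col≈0 (suc i))))
             (zeroʳ _))

  continuant : (d e : ℕ → Carrier) → ℕ → ℕ → Carrier
  continuant d e i zero          = 1#
  continuant d e i (suc zero)    = d i
  continuant d e i (suc (suc k)) =
    d i * continuant d e (suc i) (suc k) - e i * continuant d e (suc (suc i)) k

  continuant-shift : ∀ (d e : ℕ → Carrier) i k →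
    continuant (λ j → d (suc j)) (λ j → e (suc j)) i k ≡ continuant d e (suc i) k
  continuant-shift d e i zero          = ≡.refl
  continuant-shift d e i (suc zero)    = ≡.refl
  continuant-shift d e i (suc (suc k)) =
    ≡.cong₂ (λ u v → d (suc i) * u - e (suc i) * v)
      (continuant-shift d e (suc i) (suc k)) (continuant-shift d e (suc (suc i)) k)

  ZeroAboveSuperdiagonal ZeroBelowSubdiagonal : (ℕ → ℕ → Carrier) → Set ℓ₂
  ZeroAboveSuperdiagonal f = ∀ {i j} → suc i ℕ.< j → f i j ≈ 0#
  ZeroBelowSubdiagonal   f = ∀ {i j} → suc j ℕ.< i → f i j ≈ 0#

  diagonal superTimesSub : (ℕ → ℕ → Carrier) → ℕ → Carrier
  diagonal     f i = f i i
  superTimesSub f i = f i (suc i) * f (suc i) i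

  shift : (ℕ → ℕ → Carrier) → ℕ → ℕ → Carrier
  shift f i j = f (suc i) (suc j)

  det-tridiagonal-step : ∀ k (f : ℕ → ℕ → Carrier) →
    ZeroAboveSuperdiagonal f → ZeroBelowSubdiagonal f →
    det R (suc k) (λ p q → shift f (toℕ p) (toℕ q))
      ≈ continuant (diagonal (shift f)) (superTimesSub (shift f)) 0 (suc k) →
    det R k (λ p q → shift (shift f) (toℕ p) (toℕ q))
      ≈ continuant (diagonal (shift (shift f))) (superTimesSub (shift (shift f))) 0 k →
    det R (suc (suc k)) (λ p q → f (toℕ p) (toℕ q))
      ≈ continuant (diagonal f) (superTimesSub f) 0 (suc (suc k))
  det-tridiagonal-step k f up lo ih₁ ih₂ = begin
    f 0 0 * det₁ + (- (f 0 1 * (f 1 0 * det₂ + rest₂)) + rest₁)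
      ≈⟨ +-cong (*-congˡ det₁≈)
                (+-cong (-‿cong (*-congˡ (+-cong (*-congˡ det₂≈) rest₂≈0))) rest₁≈0) ⟩
    f 0 0 * cont₁ + (- (f 0 1 * (f 1 0 * cont₂ + 0#)) + 0#)
      ≈⟨ solve 5 (λ d u v c₁ c₂ → d :* c₁ :+ (:- (u :* (v :* c₂ :+ 0ₚ)) :+ 0ₚ)
                                  := d :* c₁ :- u :* v :* c₂) refl (f 0 0) (f 0 1) (f 1 0) cont₁ cont₂ ⟩
    f 0 0 * cont₁ - f 0 1 * f 1 0 * cont₂ ∎
    where
    det₁ = det R (suc k) (λ p q → shift f (toℕ p) (toℕ q))
    det₂ = det R k (λ p q → shift (shift f) (toℕ p) (toℕ q))
    cont₁ = continuant (diagonal f) (superTimesSub f) 1 (suc k)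
    cont₂ = continuant (diagonal f) (superTimesSub f) 2 k
    det₁≈ : det₁ ≈ cont₁
    det₁≈ = trans ih₁ (reflexive (continuant-shift _ _ 0 (suc k)))
    det₂≈ : det₂ ≈ cont₂
    det₂≈ = trans ih₂ (trans (reflexive (continuant-shift _ _ 0 k)) (reflexive (continuant-shift _ _ 1 k)))
    rest₁ = sumFin R k λ j → altSign R (suc (suc (toℕ j)))
      (f 0 (suc (suc (toℕ j))) * det R (suc k) (λ p q → f (suc (toℕ p)) (toℕ (punchIn (suc (suc j)) q))))
    rest₁≈0 : rest₁ ≈ 0#
    rest₁≈0 = sumFin-zero k λ j → altSign-zero (suc (suc (toℕ j)))
      (trans (*-congʳ (up (s≤s (s≤s z≤n)))) (zeroˡ _))
    rest₂ = sumFin R k λ j → altSign R (suc (toℕ j))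
      (f 1 (toℕ (punchIn (suc zero) (suc j)))
        * det R k (λ p q → f (suc (suc (toℕ p))) (toℕ (punchIn (suc zero) (punchIn (suc j) q)))))
    rest₂≈0 : rest₂ ≈ 0#
    rest₂≈0 = sumFin-zero k (term≈0 k)
      where
      term≈0 : ∀ k (j : Fin k) → altSign R (suc (toℕ j)) (f 1 (toℕ (punchIn (suc zero) (suc j)))
        * det R k (λ p q → f (suc (suc (toℕ p))) (toℕ (punchIn (suc zero) (punchIn (suc j) q))))) ≈ 0#
      term≈0 (suc k) zero    = altSign-zero 1
        (trans (*-congˡ (det-zeroColumn k
                 (λ p q → f (suc (suc (toℕ p))) (toℕ (punchIn (suc zero) (punchIn (suc zero) q))))
                 (λ _ → lo (s≤s (s≤s z≤n)))))
               (zeroʳ _))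
      term≈0 (suc k) (suc j) = altSign-zero (suc (suc (toℕ j)))
        (trans (*-congʳ (up (s≤s (s≤s (s≤s z≤n))))) (zeroˡ _))

  det-tridiagonal : ∀ m (f : ℕ → ℕ → Carrier) →
    ZeroAboveSuperdiagonal f → ZeroBelowSubdiagonal f →
    det R m (λ p q → f (toℕ p) (toℕ q)) ≈ continuant (diagonal f) (superTimesSub f) 0 m
  det-tridiagonal zero          f up lo = refl
  det-tridiagonal (suc zero)    f up lo = trans (+-identityʳ _) (*-identityʳ _)
  det-tridiagonal (suc (suc k)) f up lo = det-tridiagonal-step k f up lo
    (det-tridiagonal (suc k) (shift f) (λ h → up (s≤s h)) (λ h → lo (s≤s h)))
    (det-tridiagonal k (shift (shift f)) (λ h → up (s≤s (s≤s h))) (λ h → lo (s≤s (s≤s h))))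

  -- Continuants of Sylvester–Kac type

  prodℕ-cong : ∀ K {f g : ℕ → Carrier} → (∀ k → k ℕ.< K → f k ≈ g k) →
               prodℕ R K f ≈ prodℕ R K g
  prodℕ-cong zero    f≈g = refl
  prodℕ-cong (suc K) f≈g =
    *-cong (prodℕ-cong K (λ k k<K → f≈g k (ℕₚ.m<n⇒m<1+n k<K))) (f≈g K ℕₚ.≤-refl)

  module SylvesterKac (s c : Carrier) where

    kac : ℕ → Carrier → ℕ → Carrier
    kac zero    y i = 1#
    kac (suc K) y i = y * kac K (y + s) i + [ i ] * c * kac K y (suc i)

    kacDiagonal : ℕ → Carrier → ℕ → Carrier
    kacDiagonal m y i = y + [ m ] * s + [ i ] * c - [ m ] * c

    kacSuperTimesSub : ℕ → ℕ → Carrier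
    kacSuperTimesSub m i = [ suc i ] * [ suc m ] * (c * (s - c))

    kac-residual : ℕ → Carrier → ℕ → Carrier
    kac-residual K y i = kac (suc (suc K)) y i
      - kacDiagonal (suc K) y i * kac (suc K) y (suc i) + kacSuperTimesSub K i * kac K y (suc (suc i))

    kac-residual-zero : ∀ y i → kac-residual 0 y i ≈ 0#
    kac-residual-zero y i = solve 4 (λ y s c I →
      (y :* ((y :+ s) :* 1ₚ :+ I :* c :* 1ₚ) :+ I :* c :* (y :* 1ₚ :+ (1ₚ :+ I) :* c :* 1ₚ))
      :- (y :+ (1ₚ :+ 0ₚ) :* s :+ I :* c :- (1ₚ :+ 0ₚ) :* c) :* (y :* 1ₚ :+ (1ₚ :+ I) :* c :* 1ₚ)
      :+ (1ₚ :+ I) :* (1ₚ :+ 0ₚ) :* (c :* (s :- c)) :* 1ₚ := 0ₚ) refl y s c [ i ]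

    -- Unfolding kac once in each term reduces this to an identity in the four kac values passed last.
    kac-residual-suc : ∀ K y i →
      kac-residual (suc K) y i ≈ y * kac-residual K (y + s) i + [ suc i ] * c * kac-residual K y (suc i)
    kac-residual-suc K y i = solve 9 (λ y s c I k X₁ X₃ X₅ X₆ →
        let X₄ = y :* X₅ :+ (1ₚ :+ (1ₚ :+ I)) :* c :* X₆
            X₂ = y :* X₃ :+ (1ₚ :+ I) :* c :* X₄ in
        (y :* X₁ :+ I :* c :* X₂)
        :- (y :+ (1ₚ :+ (1ₚ :+ k)) :* s :+ I :* c :- (1ₚ :+ (1ₚ :+ k)) :* c) :* X₂
        :+ (1ₚ :+ I) :* (1ₚ :+ (1ₚ :+ k)) :* (c :* (s :- c)) :* X₄
        := y :* (X₁ :- ((y :+ s) :+ (1ₚ :+ k) :* s :+ I :* c :- (1ₚ :+ k) :* c) :* X₃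
                 :+ (1ₚ :+ I) :* (1ₚ :+ k) :* (c :* (s :- c)) :* X₅)
           :+ (1ₚ :+ I) :* c :* (X₂ :- (y :+ (1ₚ :+ k) :* s :+ (1ₚ :+ I) :* c :- (1ₚ :+ k) :* c) :* X₄
                 :+ (1ₚ :+ (1ₚ :+ I)) :* (1ₚ :+ k) :* (c :* (s :- c)) :* X₆))
      refl y s c [ i ] [ K ] (kac (suc (suc K)) (y + s) i) (kac (suc K) (y + s) (suc i))
      (kac K (y + s) (suc (suc i))) (kac K y (suc (suc (suc i))))

    kac-residual≈0 : ∀ K y i → kac-residual K y i ≈ 0#
    kac-residual≈0 zero    y i = kac-residual-zero y i
    kac-residual≈0 (suc K) y i = begin
      kac-residual (suc K) y i
        ≈⟨ kac-residual-suc K y i ⟩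
      y * kac-residual K (y + s) i + [ suc i ] * c * kac-residual K y (suc i)
        ≈⟨ +-cong (*-congˡ (kac-residual≈0 K (y + s) i)) (*-congˡ (kac-residual≈0 K y (suc i))) ⟩
      y * 0# + [ suc i ] * c * 0#
        ≈⟨ +-cong (zeroʳ _) (zeroʳ _) ⟩
      0# + 0#
        ≈⟨ +-identityʳ _ ⟩
      0# ∎

    kac-recurrence : ∀ K y i → kac (suc (suc K)) y i
      ≈ kacDiagonal (suc K) y i * kac (suc K) y (suc i) - kacSuperTimesSub K i * kac K y (suc (suc i))
    kac-recurrence K y i = begin
      u                   ≈⟨ solve 3 (λ u v w → u := (u :- v :+ w) :+ (v :- w)) refl u v w ⟩
      (u - v + w) + (v - w) ≈⟨ +-congʳ (kac-residual≈0 K y i) ⟩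
      0# + (v - w)        ≈⟨ +-identityˡ _ ⟩
      v - w               ∎
      where
      u = kac (suc (suc K)) y i
      v = kacDiagonal (suc K) y i * kac (suc K) y (suc i)
      w = kacSuperTimesSub K i * kac K y (suc (suc i))

    kac-0≈∏ : ∀ K y → kac K y 0 ≈ prodℕ R K (λ k → y + [ k ] * s)
    kac-0≈∏ zero    y = refl
    kac-0≈∏ (suc K) y = begin
      y * kac K (y + s) 0 + 0# * c * kac K y 1
        ≈⟨ +-cong (*-congˡ (kac-0≈∏ K (y + s))) (trans (*-congʳ (zeroˡ c)) (zeroˡ _)) ⟩
      y * prodℕ R K (λ k → (y + s) + [ k ] * s) + 0# ≈⟨ +-identityʳ _ ⟩
      y * prodℕ R K (λ k → (y + s) + [ k ] * s)      ≈⟨ ∏-shift K ⟨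
      prodℕ R (suc K) (λ k → y + [ k ] * s)          ∎
      where
      ∏-shift : ∀ K → prodℕ R (suc K) (λ k → y + [ k ] * s)
                    ≈ y * prodℕ R K (λ k → (y + s) + [ k ] * s)
      ∏-shift zero    = solve 2 (λ y s → 1ₚ :* (y :+ 0ₚ :* s) := y :* 1ₚ) refl y s
      ∏-shift (suc K) = begin
        prodℕ R (suc K) (λ k → y + [ k ] * s) * (y + (1# + [ K ]) * s)  ≈⟨ *-congʳ (∏-shift K) ⟩
        (y * p) * (y + (1# + [ K ]) * s)
          ≈⟨ solve 4 (λ y s k p → (y :* p) :* (y :+ (1ₚ :+ k) :* s) := y :* (p :* ((y :+ s) :+ k :* s)))
                     refl y s [ K ] p ⟩
        y * (p * ((y + s) + [ K ] * s)) ∎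
        where p = prodℕ R K (λ k → (y + s) + [ k ] * s)

    continuant≈kac : ∀ (d e : ℕ → Carrier) n y →
      (∀ i m → i ℕ.+ m ≡ n → d i ≈ kacDiagonal m y i) →
      (∀ i m → i ℕ.+ suc m ≡ n → e i ≈ kacSuperTimesSub m i) →
      ∀ K i → i ℕ.+ K ≡ suc n → continuant d e i K ≈ kac K y i
    continuant≈kac d e n y d≈ e≈ zero i _ = refl
    continuant≈kac d e n y d≈ e≈ (suc zero) i i+1≡1+n = begin
      d i
        ≈⟨ d≈ i 0 (ℕₚ.suc-injective (≡.trans (≡.sym (ℕₚ.+-suc i 0)) i+1≡1+n)) ⟩
      y + 0# * s + [ i ] * c - 0# * c
        ≈⟨ solve 4 (λ y s c I → y :+ 0ₚ :* s :+ I :* c :- 0ₚ :* c := y :* 1ₚ :+ I :* c :* 1ₚ)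
                   refl y s c [ i ] ⟩
      y * 1# + [ i ] * c * 1# ∎
    continuant≈kac d e n y d≈ e≈ (suc (suc K)) i i+K+2≡1+n = begin
      d i * continuant d e (suc i) (suc K) - e i * continuant d e (suc (suc i)) K
        ≈⟨ +-cong (*-cong (d≈ i (suc K) i+K+1≡n) (ih (suc K) (suc i) (≡.cong suc i+K+1≡n)))
                  (-‿cong (*-cong (e≈ i K i+K+1≡n) (ih K (suc (suc i)) i+K+2≡1+n′))) ⟩
      kacDiagonal (suc K) y i * kac (suc K) y (suc i) - kacSuperTimesSub K i * kac K y (suc (suc i))
        ≈⟨ kac-recurrence K y i ⟨
      kac (suc (suc K)) y i ∎
      where
      ih = continuant≈kac d e n y d≈ e≈
      i+K+1≡n : i ℕ.+ suc K ≡ n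
      i+K+1≡n = ℕₚ.suc-injective (≡.trans (≡.sym (ℕₚ.+-suc i (suc K))) i+K+2≡1+n)
      i+K+2≡1+n′ : suc (suc i) ℕ.+ K ≡ suc n
      i+K+2≡1+n′ = ≡.trans (≡.cong suc (≡.sym (ℕₚ.+-suc i K))) (≡.cong suc i+K+1≡n)

  pm-not : ∀ σ u → pm R (not σ) u ≈ - pm R σ u
  pm-not true  u = refl
  pm-not false u = sym (-‿involutive u)

  pm-*ˡ : ∀ σ u v → pm R σ (u * v) ≈ u * pm R σ v
  pm-*ˡ true  u v = refl
  pm-*ˡ false u v = -‿distribʳ-* u v

  module CharacteristicMatrix (σ : Bool) (n : ℕ) (a b r x : Carrier) where

    entryM : ℕ → ℕ → Carrier
    entryM i j with i ℕ.≟ j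
    ... | yes _ = ([ n ∸ i ] * a + pm R σ ([ i ] * b)) * r
    ... | no  _ with suc i ℕ.≟ j
    ...   | yes _ = [ j ] * b
    ...   | no  _ with i ℕ.≟ suc j
    ...     | yes _ = [ n ∸ j ] * a
    ...     | no  _ = 0#

    xI-entry : ℕ → ℕ → Carrier → Carrier
    xI-entry i j v with i ℕ.≟ j
    ... | yes _ = x - v
    ... | no  _ = - v

    entry : ℕ → ℕ → Carrier
    entry i j = xI-entry i j (entryM i j)

    M≡entryM : ∀ i j → M R σ n a b r i j ≡ entryM (toℕ i) (toℕ j)
    M≡entryM i j with toℕ i ℕ.≟ toℕ j
    ... | yes _ = ≡.refl
    ... | no  _ with suc (toℕ i) ℕ.≟ toℕ j
    ...   | yes _ = ≡.refl
    ...   | no  _ with toℕ i ℕ.≟ suc (toℕ j)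
    ...     | yes _ = ≡.refl
    ...     | no  _ = ≡.refl

    charMat≡xI-entry : ∀ (A : Matrix R (suc n)) i j →
                       charMat R (suc n) x A i j ≡ xI-entry (toℕ i) (toℕ j) (A i j)
    charMat≡xI-entry A i j with toℕ i ℕ.≟ toℕ j
    ... | yes _ = ≡.refl
    ... | no  _ = ≡.refl

    charMat≡entry : ∀ i j → charMat R (suc n) x (M R σ n a b r) i j ≡ entry (toℕ i) (toℕ j)
    charMat≡entry i j =
      ≡.trans (charMat≡xI-entry _ i j) (≡.cong (xI-entry (toℕ i) (toℕ j)) (M≡entryM i j))

    entry-diagonal : ∀ i → entry i i ≈ x - ([ n ∸ i ] * a + pm R σ ([ i ] * b)) * r
    entry-diagonal i with i ℕ.≟ i
    ... | yes _  = refl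
    ... | no i≢i = contradiction ≡.refl i≢i

    entry-super : ∀ i → entry i (suc i) ≈ - ([ suc i ] * b)
    entry-super i with i ℕ.≟ suc i
    ... | yes i≡1+i = contradiction i≡1+i (ℕₚ.<⇒≢ (ℕₚ.n<1+n i))
    ... | no  _ with suc i ℕ.≟ suc i
    ...   | yes _      = refl
    ...   | no  1+i≢1+i = contradiction ≡.refl 1+i≢1+i

    entry-sub : ∀ i → entry (suc i) i ≈ - ([ n ∸ i ] * a)
    entry-sub i with suc i ℕ.≟ i
    ... | yes 1+i≡i = contradiction 1+i≡i (ℕₚ.>⇒≢ (ℕₚ.n<1+n i))
    ... | no  _ with suc (suc i) ℕ.≟ i
    ...   | yes 2+i≡i = contradiction 2+i≡i (ℕₚ.>⇒≢ (ℕₚ.m<n⇒m<1+n (ℕₚ.n<1+n i)))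
    ...   | no  _ with suc i ℕ.≟ suc i
    ...     | yes _       = refl
    ...     | no  1+i≢1+i = contradiction ≡.refl 1+i≢1+i

    entry-zeroAbove : ZeroAboveSuperdiagonal entry
    entry-zeroAbove {i} {j} 1+i<j with i ℕ.≟ j
    ... | yes i≡j = contradiction i≡j (ℕₚ.<⇒≢ (ℕₚ.<⇒≤ 1+i<j))
    ... | no  _ with suc i ℕ.≟ j
    ...   | yes 1+i≡j = contradiction 1+i≡j (ℕₚ.<⇒≢ 1+i<j)
    ...   | no  _ with i ℕ.≟ suc j
    ...     | yes i≡1+j = contradiction i≡1+j (ℕₚ.<⇒≢ (ℕₚ.m<n⇒m<1+n (ℕₚ.<⇒≤ 1+i<j)))
    ...     | no  _     = -0#≈0#

    entry-zeroBelow : ZeroBelowSubdiagonal entry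
    entry-zeroBelow {i} {j} 1+j<i with i ℕ.≟ j
    ... | yes i≡j = contradiction i≡j (ℕₚ.>⇒≢ (ℕₚ.<⇒≤ 1+j<i))
    ... | no  _ with suc i ℕ.≟ j
    ...   | yes 1+i≡j = contradiction 1+i≡j (ℕₚ.>⇒≢ (ℕₚ.m<n⇒m<1+n (ℕₚ.<⇒≤ 1+j<i)))
    ...   | no  _ with i ℕ.≟ suc j
    ...     | yes i≡1+j = contradiction i≡1+j (ℕₚ.>⇒≢ 1+j<i)
    ...     | no  _     = -0#≈0#

  module Spectrum (h : Carrier) (h+h≈1 : h + h ≈ 1#) (σ : Bool) (n : ℕ) (a b r s : Carrier)
    (s²≈ : s * s ≈ fromℕ R 4 * a * b + r * r * ((a + pm R (not σ) b) * (a + pm R (not σ) b)))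
    (x : Carrier) where

    open CharacteristicMatrix σ n a b r x public

    -- The solver cannot use h + h ≈ 1#; identities involving h are proved with an
    -- extra summand (1 - (h + h)) * w, which this lemma then discards.
    cancel-half : ∀ {u v} w → u + (1# - (h + h)) * w ≈ v → u ≈ v
    cancel-half {u} {v} w u+0≈v = begin
      u                       ≈⟨ solve 2 (λ u w → u := u :+ (1ₚ :- 1ₚ) :* w) refl u w ⟩
      u + (1# - 1#) * w       ≈⟨ +-congˡ (*-congʳ (+-congˡ (-‿cong (sym h+h≈1)))) ⟩
      u + (1# - (h + h)) * w  ≈⟨ u+0≈v ⟩
      v                       ∎

    B c y : Carrier
    B = pm R σ b
    c = h * (r * (a + pm R (not σ) b) + s)
    y = x - [ n ] * (h * (r * (a + B) + s))

    open SylvesterKac s c public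

    c[s-c]≈ab : c * (s - c) ≈ a * b
    c[s-c]≈ab = begin
      c * (s - c)
        ≈⟨ *-congˡ (cancel-half (- s) (solve 3 (λ s h U →
             (s :- h :* (U :+ s)) :+ (1ₚ :- (h :+ h)) :* (:- s) := h :* (s :- U)) refl s h U)) ⟩
      c * (h * (s - U))
        ≈⟨ solve 3 (λ h U s → h :* (U :+ s) :* (h :* (s :- U)) := h :* h :* (s :* s :- U :* U))
                   refl h U s ⟩
      h * h * (s * s - U * U)
        ≈⟨ *-congˡ (+-congʳ s²≈) ⟩
      h * h * ((fromℕ R 4 * a * b + r * r * (v * v)) - U * U)
        ≈⟨ *-congˡ (solve 3 (λ X r v → (X :+ r :* r :* (v :* v)) :- (r :* v) :* (r :* v) := X)
                            refl _ r v) ⟩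
      h * h * (fromℕ R 4 * a * b)
        ≈⟨ cancel-half ((1# + (h + h)) * a * b) (solve 3 (λ h a b →
             h :* h :* ((1ₚ :+ (1ₚ :+ (1ₚ :+ (1ₚ :+ 0ₚ)))) :* a :* b)
             :+ (1ₚ :- (h :+ h)) :* ((1ₚ :+ (h :+ h)) :* a :* b) := a :* b) refl h a b) ⟩
      a * b ∎
      where
      v = a + pm R (not σ) b
      U = r * v

    entry-diagonal≈kac : ∀ i m → i ℕ.+ m ≡ n → entry i i ≈ kacDiagonal m y i
    entry-diagonal≈kac i m i+m≡n = begin
      entry i i
        ≈⟨ entry-diagonal i ⟩
      x - ([ n ∸ i ] * a + pm R σ ([ i ] * b)) * r
        ≡⟨ ≡.cong (λ k → x - ([ k ] * a + pm R σ ([ i ] * b)) * r) n∸i≡m ⟩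
      x - ([ m ] * a + pm R σ ([ i ] * b)) * r
        ≈⟨ +-congˡ (-‿cong (*-congʳ (+-congˡ (pm-*ˡ σ [ i ] b)))) ⟩
      x - ([ m ] * a + [ i ] * B) * r
        ≈⟨ cancel-half _ (solve 8 (λ x a B r s h I M →
             (x :- (M :* a :+ I :* B) :* r) :+ (1ₚ :- (h :+ h)) :* (M :* r :* a :+ I :* r :* B :+ M :* s)
             := (x :- (I :+ M) :* (h :* (r :* (a :+ B) :+ s))) :+ M :* s :+ I :* (h :* (r :* (a :- B) :+ s))
                :- M :* (h :* (r :* (a :- B) :+ s))) refl x a B r s h [ i ] [ m ]) ⟩
      x - ([ i ] + [ m ]) * d + [ m ] * s + [ i ] * c′ - [ m ] * c′
        ≈⟨ +-cong (+-cong (+-congʳ (+-congˡ (-‿cong (*-congʳ (fromℕ-+≡ i m i+m≡n))))) (*-congˡ c′≈c))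
                  (-‿cong (*-congˡ c′≈c)) ⟩
      kacDiagonal m y i ∎
      where
      d  = h * (r * (a + B) + s)
      c′ = h * (r * (a - B) + s)
      n∸i≡m : n ∸ i ≡ m
      n∸i≡m = ≡.trans (≡.cong (_∸ i) (≡.sym i+m≡n)) (ℕₚ.m+n∸m≡n i m)
      c′≈c : c′ ≈ c
      c′≈c = *-congˡ (+-congʳ (*-congˡ (+-congˡ (sym (pm-not σ b)))))

    entry-superTimesSub≈kac : ∀ i m → i ℕ.+ suc m ≡ n → superTimesSub entry i ≈ kacSuperTimesSub m i
    entry-superTimesSub≈kac i m i+1+m≡n = begin
      entry i (suc i) * entry (suc i) i
        ≈⟨ *-cong (entry-super i) (entry-sub i) ⟩
      (- ([ suc i ] * b)) * (- ([ n ∸ i ] * a))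
        ≡⟨ ≡.cong (λ k → (- ([ suc i ] * b)) * (- ([ k ] * a))) n∸i≡1+m ⟩
      (- ([ suc i ] * b)) * (- ([ suc m ] * a))
        ≈⟨ solve 4 (λ I M a b → (:- (I :* b)) :* (:- (M :* a)) := I :* M :* (a :* b))
                   refl [ suc i ] [ suc m ] a b ⟩
      [ suc i ] * [ suc m ] * (a * b)
        ≈⟨ *-congˡ c[s-c]≈ab ⟨
      kacSuperTimesSub m i ∎
      where
      n∸i≡1+m : n ∸ i ≡ suc m
      n∸i≡1+m = ≡.trans (≡.cong (_∸ i) (≡.sym i+1+m≡n)) (ℕₚ.m+n∸m≡n i (suc m))

    x-eigen≈y+ks : ∀ k → k ℕ.< suc n → x - eigen R σ n a b r h s k ≈ y + [ k ] * s
    x-eigen≈y+ks k k≤n = begin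
      x - h * ([ n ] * r * (a + B) + ([ n ∸ k ] * s - [ k ] * s))
        ≈⟨ +-congˡ (-‿cong (*-congˡ (+-congʳ (*-congʳ (*-congʳ (sym [k]+[m]≈[n])))))) ⟩
      x - h * (([ k ] + [ m ]) * r * (a + B) + ([ m ] * s - [ k ] * s))
        ≈⟨ cancel-half ([ k ] * s) (solve 8 (λ x h r a B s K M →
             (x :- h :* ((K :+ M) :* r :* (a :+ B) :+ (M :* s :- K :* s))) :+ (1ₚ :- (h :+ h)) :* (K :* s)
             := x :- (K :+ M) :* (h :* (r :* (a :+ B) :+ s)) :+ K :* s) refl x h r a B s [ k ] [ m ]) ⟩
      x - ([ k ] + [ m ]) * (h * (r * (a + B) + s)) + [ k ] * s
        ≈⟨ +-congʳ (+-congˡ (-‿cong (*-congʳ [k]+[m]≈[n]))) ⟩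
      y + [ k ] * s ∎
      where
      m = n ∸ k
      [k]+[m]≈[n] : [ k ] + [ m ] ≈ [ n ]
      [k]+[m]≈[n] = fromℕ-+≡ k m (ℕₚ.m+[n∸m]≡n (ℕₚ.≤-pred k≤n))

theorem2 : {c ℓ : Level} (R : CommutativeRing c ℓ) →
    let open CommutativeRing R in
    (half : Carrier) → half + half ≈ 1# →
    (σ : Bool) (n : ℕ) (a b r s : Carrier) →
    s * s ≈ fromℕ R 4 * a * b + r * r * ((a + pm R (not σ) b) * (a + pm R (not σ) b)) →
    (x : Carrier) →
    charPoly R (suc n) (M R σ n a b r) x ≈ prodℕ R (suc n) (λ k → x - eigen R σ n a b r half s k)
theorem2 R h h+h≈1 σ n a b r s s²≈ x = begin
  det R (suc n) (charMat R (suc n) x (M R σ n a b r))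
    ≈⟨ det-cong R (suc n) (λ i j → reflexive (charMat≡entry i j)) ⟩
  det R (suc n) (λ i j → entry (toℕ i) (toℕ j))
    ≈⟨ det-tridiagonal R (suc n) entry entry-zeroAbove entry-zeroBelow ⟩
  continuant R (diagonal R entry) (superTimesSub R entry) 0 (suc n)
    ≈⟨ continuant≈kac (diagonal R entry) (superTimesSub R entry) n y
         entry-diagonal≈kac entry-superTimesSub≈kac (suc n) 0 ≡.refl ⟩
  kac (suc n) y 0
    ≈⟨ kac-0≈∏ (suc n) y ⟩
  prodℕ R (suc n) (λ k → y + fromℕ R k * s)
    ≈⟨ prodℕ-cong R (suc n) x-eigen≈y+ks ⟨
  prodℕ R (suc n) (λ k → x - eigen R σ n a b r h s k) ∎
  where
  open CommutativeRing R
  open Relation.Binary.Reasoning.Setoid setoid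
  open Spectrum R h h+h≈1 σ n a b r s s²≈ x
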